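{- Let $\pi$ be a length-$k$ permutation whose permutation matrix contains a point at one of the two corners of the first column (i.e. at coordinate $(1,1)$ or $(1,k)$). Then, for $c\ge 2k$, $f(c,\pi)=O(c)\cdot f(c,\widehat\pi)$, where $\widehat\pi$ is any permutation with ${\sf dleft}(\pi)={\sf dleft}(\widehat\pi)$. Similarly, if the permutation matrix of $\pi$ contains a point at one of the two corners of the last column (i.e. at $(k,1)$ or $(k,k)$), then $f(c,\pi)=O(c)\cdot f(c,\widehat\pi)$, where $\widehat\pi$ is any permutation with ${\sf dright}(\pi)={\sf dright}(\widehat\pi)$.
   Context: A permutation $\pi$ of length $k$ is identified with the $k\times k$ 0/1 matrix with a 1 in column $i$, row $\pi(i)$. A 0/1 matrix $M$ contains a pattern matrix $P$ if $P$ can be obtained from $M$ by deleting rows, columns, and turning 1-entries into 0; otherwise $M$ avoids $P$. For a permutation $\pi$ and integer $c\ge2|\pi|$, $f(c,\pi)$ is the maximum number $r$ such that there exists a 0/1 matrix with $r$ rows and $c$ columns in which every row has at least $2|\pi|$ ones and which avoids $\pi$. ${\sf dleft}(\pi)$ is the permutation obtained by deleting the point in the leftmost column of the matrix of $\pi$ together with its row and column (i.e. deleting the first entry and standardizing); ${\sf dright}(\pi)$ is defined analogously with the rightmost column. -}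

module Defs where

open import Data.Nat using (ℕ; suc; _*_; _≤_)
open import Data.Fin using (Fin; zero; fromℕ; _<_)
open import Data.Fin.Subset using (Subset; _∈_; ∣_∣)
open import Data.Fin.Permutation using (Permutation′; _⟨$⟩ʳ_; remove)
open import Data.Product using (∃; _×_)
open import Relation.Nullary using (¬_)

-- A 0/1 matrix with r rows and c columns: each row is a subset of the
-- column set (the columns holding a 1 in that row).
Matrix : ℕ → ℕ → Set
Matrix r c = Fin r → Subset c

StrictlyIncreasing : ∀ {a b} → (Fin a → Fin b) → Set
StrictlyIncreasing f = ∀ i j → i < j → f i < f j

-- The permutation matrix of π has a 1 in column i, row π(i).
Contains : ∀ {r c k} → Matrix r c → Permutation′ k → Set
Contains {r} {c} {k} M π =
  ∃ λ (ρ : Fin k → Fin r) → ∃ λ (γ : Fin k → Fin c) →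
    StrictlyIncreasing ρ × StrictlyIncreasing γ ×
    (∀ i → γ i ∈ M (ρ (π ⟨$⟩ʳ i)))

Avoids : ∀ {r c k} → Matrix r c → Permutation′ k → Set
Avoids M π = ¬ Contains M π

Admissible : ∀ {k} → (c : ℕ) → Permutation′ k → ℕ → Set
Admissible {k} c π r =
  ∃ λ (M : Matrix r c) → (∀ i → 2 * k ≤ ∣ M i ∣) × Avoids M π

IsF : ∀ {k} → (c : ℕ) → Permutation′ k → ℕ → Set
IsF c π r = Admissible c π r × (∀ r′ → Admissible c π r′ → r′ ≤ r)

dleft : ∀ {n} → Permutation′ (suc n) → Permutation′ n
dleft π = remove zero π

dright : ∀ {n} → Permutation′ (suc n) → Permutation′ n
dright {n} π = remove (fromℕ n) π

{-# OPTIONS --safe #-}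
module Submission where

-- Let x be the first or last column of π, with π(x) the top or bottom row.
-- Anchor every row of a π-avoiding matrix M at its leftmost 1 (x first) or
-- rightmost 1 (x last). Among the rows anchored at a column a, delete the
-- extreme one on the side of π(x). The remaining rows avoid π̂: in an
-- occurrence of π̂ there, the point in column x can be swapped for the deleted
-- row's 1 in column a, which lies beyond all other points of the occurrence,
-- giving an occurrence of π in M. So each column anchors at most f(c, π̂) + 1
-- rows, and f(c, π) ≤ c (f(c, π̂) + 1) ≤ 2 c f(c, π̂), as f(c, π̂) ≥ 1 whenever
-- f(c, π) ≥ 1.

open import Data.Bool.Base using (if_then_else_)
open import Data.Empty using (⊥-elim)
open import Data.Fin.Base using (Fin; zero; suc; fromℕ; punchIn; punchOut)
  renaming (_<_ to _<ᶠ_; _≤_ to _≤ᶠ_)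
open import Data.Fin.Permutation using (Permutation′; _⟨$⟩ʳ_; _≈_; remove; punchIn-permute)
open import Data.Fin.Properties using (_≟_; punchIn-punchOut; punchIn-mono-≤; punchIn-cancel-≤)
open import Data.Fin.Subset using (Subset; inside; outside; _∈_; ∣_∣; Nonempty; ⊤)
open import Data.Fin.Subset.Properties using (nonempty?; ∣⊤∣≡n)
open import Data.Nat.Base using (ℕ; zero; suc; _+_; _*_; _≤_; _<_; z≤n; s≤s)
open import Data.Nat.Properties as ℕ using (+-0-commutativeMonoid)
open import Data.Nat.Tactic.RingSolver using (solve-∀)
open import Data.Product using (∃; _×_; _,_; proj₁; proj₂)
open import Data.Sum using (_⊎_; inj₁; inj₂)
open import Data.Vec.Base using (_∷_; here; there)
open import Data.Vec.Functional using (insertAt)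
open import Data.Vec.Functional.Properties using (insertAt-lookup; insertAt-punchIn)
open import Function.Base using (_∘_)
open import Level using (Level)
open import Relation.Binary.PropositionalEquality using (_≡_; refl; sym; trans; cong; subst)
open import Relation.Nullary using (Dec; does; yes; no)
open import Relation.Unary using (Pred; Decidable)

open import Algebra.Properties.CommutativeMonoid.Sum +-0-commutativeMonoid
  using (sum-syntax; ∑-comm; sum-cong-≗; sum-replicate-zero)

open import Defs

private
  variable
    ℓ : Level
    n m r c t : ℕ

indicator : {A : Set ℓ} → Dec A → ℕ
indicator A? = if does A? then 1 else 0

count : {P : Pred (Fin r) ℓ} → Decidable P → ℕ
count {r = r} P? = ∑[ i < r ] indicator (P? i)

enumerate : {P : Pred (Fin r) ℓ} (P? : Decidable P) →
  ∃ λ (h : Fin (count P?) → Fin r) → StrictlyIncreasing h × (∀ j → P (h j))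
enumerate {r = zero}  P? = (λ ()) , (λ ()) , (λ ())
enumerate {r = suc r} {P = P} P? with P? zero | enumerate (P? ∘ suc)
... | no _   | h , h↑ , hP = suc ∘ h , (λ i j i<j → s≤s (h↑ i j i<j)) , hP
... | yes p₀ | h , h↑ , hP = h′ , h′↑ , h′P
  where
  h′ : Fin (suc (count (P? ∘ suc))) → Fin (suc r)
  h′ zero    = zero
  h′ (suc j) = suc (h j)
  h′↑ : StrictlyIncreasing h′
  h′↑ zero    (suc j) _         = s≤s z≤n
  h′↑ (suc i) (suc j) (s≤s i<j) = s≤s (h↑ i j i<j)
  h′P : ∀ j → P (h′ j)
  h′P zero    = p₀
  h′P (suc j) = hP j

∑-indicator-≟ : (x : Fin c) → ∑[ a < c ] indicator (x ≟ a) ≡ 1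
∑-indicator-≟ {c = suc c} zero    = cong suc (sum-replicate-zero c)
∑-indicator-≟ {c = suc c} (suc x) = ∑-indicator-≟ x

∑-const-1 : ∀ r → ∑[ i < r ] 1 ≡ r
∑-const-1 zero    = refl
∑-const-1 (suc r) = cong suc (∑-const-1 r)

∑-fibres : (f : Fin r → Fin c) → ∑[ a < c ] count (λ i → f i ≟ a) ≡ r
∑-fibres {r = r} {c = c} f = begin
  ∑[ a < c ] ∑[ i < r ] indicator (f i ≟ a)  ≡⟨ sym (∑-comm (λ i a → indicator (f i ≟ a))) ⟩
  ∑[ i < r ] ∑[ a < c ] indicator (f i ≟ a)  ≡⟨ sum-cong-≗ (∑-indicator-≟ ∘ f) ⟩
  ∑[ i < r ] 1                               ≡⟨ ∑-const-1 r ⟩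
  r                                          ∎
  where open Relation.Binary.PropositionalEquality.≡-Reasoning

∑-≤ : (g : Fin c → ℕ) → (∀ a → g a ≤ m) → ∑[ a < c ] g a ≤ c * m
∑-≤ {c = zero}  g g≤ = z≤n
∑-≤ {c = suc c} g g≤ = ℕ.+-mono-≤ (g≤ zero) (∑-≤ (g ∘ suc) (g≤ ∘ suc))

∣p∣>0⇒nonempty : (S : Subset c) → 0 < ∣ S ∣ → Nonempty S
∣p∣>0⇒nonempty (inside  ∷ S) _   = zero , here
∣p∣>0⇒nonempty (outside ∷ S) pos with ∣p∣>0⇒nonempty S pos
... | a , a∈S = suc a , there a∈S

minimum : (S : Subset c) → Nonempty S → ∃ λ a → a ∈ S × (∀ {b} → b ∈ S → a ≤ᶠ b)
minimum (inside  ∷ S) _ = zero , here , λ _ → z≤n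
minimum (outside ∷ S) (zero  , ())
minimum (outside ∷ S) (suc b , there b∈S) with minimum S (b , b∈S)
... | a , a∈S , a≤ = suc a , there a∈S , λ { (there b∈S) → s≤s (a≤ b∈S) }

maximum : (S : Subset c) → Nonempty S → ∃ λ a → a ∈ S × (∀ {b} → b ∈ S → b ≤ᶠ a)
maximum (s ∷ S) ne with nonempty? S
... | yes neS with maximum S neS
...   | a , a∈S , ≤a = suc a , there a∈S , λ { here → z≤n ; (there b∈S) → s≤s (≤a b∈S) }
maximum (s ∷ S) (zero  , 0∈) | no ¬neS = zero , 0∈ , λ { here → z≤n ; (there b∈S) → ⊥-elim (¬neS (_ , b∈S)) }
maximum (s ∷ S) (suc b , there b∈S) | no ¬neS = ⊥-elim (¬neS (b , b∈S))

≡-or-punchIn : (x y : Fin (suc n)) → y ≡ x ⊎ ∃ λ j → y ≡ punchIn x j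
≡-or-punchIn x y with x ≟ y
... | yes x≡y = inj₁ (sym x≡y)
... | no  x≢y = inj₂ (punchOut x≢y , sym (punchIn-punchOut x≢y))

punchIn-mono-< : (x : Fin (suc n)) {j k : Fin n} → j <ᶠ k → punchIn x j <ᶠ punchIn x k
punchIn-mono-< x {j} {k} j<k = ℕ.≰⇒> (ℕ.<⇒≱ j<k ∘ punchIn-cancel-≤ x k j)

punchIn-cancel-< : (x : Fin (suc n)) {j k : Fin n} → punchIn x j <ᶠ punchIn x k → j <ᶠ k
punchIn-cancel-< x {j} {k} lt = ℕ.≰⇒> (ℕ.<⇒≱ lt ∘ punchIn-mono-≤ x k j)

punchIn[fromℕ]<fromℕ : (j : Fin n) → punchIn (fromℕ n) j <ᶠ fromℕ n
punchIn[fromℕ]<fromℕ zero    = s≤s z≤n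
punchIn[fromℕ]<fromℕ (suc j) = s≤s (punchIn[fromℕ]<fromℕ j)

InsertableAt : Fin (suc n) → Fin m → (Fin n → Fin m) → Set
InsertableAt x v f = ∀ j → (punchIn x j <ᶠ x → f j <ᶠ v) × (x <ᶠ punchIn x j → v <ᶠ f j)

insertAt-strictlyIncreasing : ∀ {x : Fin (suc n)} {v : Fin m} {f} →
  StrictlyIncreasing f → InsertableAt x v f → StrictlyIncreasing (insertAt f x v)
insertAt-strictlyIncreasing {x = x} {v} {f} f↑ fits i j i<j with ≡-or-punchIn x i | ≡-or-punchIn x j
... | inj₁ refl | inj₁ refl = ⊥-elim (ℕ.<-irrefl refl i<j)
... | inj₁ refl | inj₂ (l , refl)
  rewrite insertAt-lookup f x v | insertAt-punchIn f x v l = proj₂ (fits l) i<j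
... | inj₂ (k , refl) | inj₁ refl
  rewrite insertAt-lookup f x v | insertAt-punchIn f x v k = proj₁ (fits k) i<j
... | inj₂ (k , refl) | inj₂ (l , refl)
  rewrite insertAt-punchIn f x v k | insertAt-punchIn f x v l = f↑ k l (punchIn-cancel-< x i<j)

insertableAt-∘ : ∀ {x : Fin (suc n)} {v : Fin m} {f} {h : Fin m → Fin r} →
  StrictlyIncreasing h → InsertableAt x v f → InsertableAt x (h v) (h ∘ f)
insertableAt-∘ h↑ fits j = (h↑ _ _ ∘ proj₁ (fits j)) , (h↑ _ _ ∘ proj₂ (fits j))

insertableAt-zero : ∀ {v : Fin m} {f : Fin n → Fin m} → (∀ j → v <ᶠ f j) → InsertableAt zero v f
insertableAt-zero v< j = (λ ()) , (λ _ → v< j)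

insertableAt-fromℕ : ∀ {v : Fin m} {f : Fin n → Fin m} → (∀ j → f j <ᶠ v) → InsertableAt (fromℕ n) v f
insertableAt-fromℕ <v j = (λ _ → <v j) , (λ lt → ⊥-elim (ℕ.<-asym lt (punchIn[fromℕ]<fromℕ j)))

Extreme : Fin (suc n) → Set
Extreme {n} x = x ≡ zero ⊎ x ≡ fromℕ n

-- An extreme row of the pattern can be matched by the first or last of any
-- t + 1 rows, the other t rows then lying on the correct side of it.
extreme-insertable : {p : Fin (suc n)} → Extreme p → ∀ t →
  ∃ λ (e : Fin (suc t)) → ∀ (g : Fin n → Fin t) → InsertableAt p e (punchIn e ∘ g)
extreme-insertable (inj₁ refl) t = zero , λ g → insertableAt-zero (λ _ → s≤s z≤n)
extreme-insertable (inj₂ refl) t = fromℕ t , λ g → insertableAt-fromℕ (punchIn[fromℕ]<fromℕ ∘ g)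

IsOccurrence : {k : ℕ} → Matrix r c → Permutation′ k → (Fin k → Fin r) → (Fin k → Fin c) → Set
IsOccurrence M π ρ γ = StrictlyIncreasing ρ × StrictlyIncreasing γ × (∀ i → γ i ∈ M (ρ (π ⟨$⟩ʳ i)))

isOccurrence-∘ : {k : ℕ} {M : Matrix r c} {π : Permutation′ k}
  {ρ : Fin k → Fin t} {γ : Fin k → Fin c} {g : Fin t → Fin r} →
  StrictlyIncreasing g → IsOccurrence (M ∘ g) π ρ γ → IsOccurrence M π (g ∘ ρ) γ
isOccurrence-∘ g↑ (ρ↑ , γ↑ , hit) = (λ i j i<j → g↑ _ _ (ρ↑ i j i<j)) , γ↑ , hit

replace-point : {M : Matrix r c} (π π̂ : Permutation′ (suc n)) (x : Fin (suc n)) →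
  remove x π ≈ remove x π̂ → ∀ {ρ γ} → IsOccurrence M π̂ ρ γ →
  ∀ {R a} → a ∈ M R →
  InsertableAt (π ⟨$⟩ʳ x) R (ρ ∘ punchIn (π̂ ⟨$⟩ʳ x)) →
  InsertableAt x a (γ ∘ punchIn x) →
  Contains M π
replace-point {M = M} π π̂ x π≈π̂ {ρ} {γ} (ρ↑ , γ↑ , hit) {R} {a} a∈MR fitsRow fitsCol =
  ρ′ , γ′ , ρ′↑ , γ′↑ , hit′
  where
  p = π ⟨$⟩ʳ x
  ρ′ = insertAt (ρ ∘ punchIn (π̂ ⟨$⟩ʳ x)) p R
  γ′ = insertAt (γ ∘ punchIn x) x a
  ρ′↑ : StrictlyIncreasing ρ′
  ρ′↑ = insertAt-strictlyIncreasing (λ i j → ρ↑ _ _ ∘ punchIn-mono-< _) fitsRow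
  γ′↑ : StrictlyIncreasing γ′
  γ′↑ = insertAt-strictlyIncreasing (λ i j → γ↑ _ _ ∘ punchIn-mono-< x) fitsCol
  hit′ : ∀ i → γ′ i ∈ M (ρ′ (π ⟨$⟩ʳ i))
  hit′ i with ≡-or-punchIn x i
  ... | inj₁ refl
    rewrite insertAt-lookup (γ ∘ punchIn x) x a | insertAt-lookup (ρ ∘ punchIn (π̂ ⟨$⟩ʳ x)) p R = a∈MR
  ... | inj₂ (j , refl)
    rewrite insertAt-punchIn (γ ∘ punchIn x) x a j
          | punchIn-permute π x j
          | insertAt-punchIn (ρ ∘ punchIn (π̂ ⟨$⟩ʳ x)) p R (remove x π ⟨$⟩ʳ j)
          | π≈π̂ j
          | sym (punchIn-permute π̂ x j) = hit (punchIn x j)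

Anchors : Fin (suc n) → Subset c → Fin c → Set
Anchors {n} {c} x S a =
  a ∈ S × (∀ (γ : Fin (suc n) → Fin c) → StrictlyIncreasing γ → γ x ∈ S → InsertableAt x a (γ ∘ punchIn x))

anchor : {x : Fin (suc n)} → Extreme x → (S : Subset c) → Nonempty S → ∃ (Anchors x S)
anchor (inj₁ refl) S ne with minimum S ne
... | a , a∈S , a≤ = a , a∈S , λ γ γ↑ γ₀∈S →
  insertableAt-zero (λ j → ℕ.≤-<-trans (a≤ γ₀∈S) (γ↑ zero (suc j) (s≤s z≤n)))
anchor (inj₂ refl) S ne with maximum S ne
... | a , a∈S , ≤a = a , a∈S , λ γ γ↑ γₙ∈S →
  insertableAt-fromℕ (λ j → ℕ.<-≤-trans (γ↑ _ _ (punchIn[fromℕ]<fromℕ j)) (≤a γₙ∈S))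

module _ {π π̂ : Permutation′ (suc n)} {x : Fin (suc n)}
         (π≈π̂ : remove x π ≈ remove x π̂) (p-extreme : Extreme (π ⟨$⟩ʳ x))
         {M : Matrix r c} (M-avoids : Avoids M π)
         {L : Fin r → Fin c} (L-anchors : ∀ i → Anchors x (M i) (L i)) where

  fibre-avoids : ∀ {a} (h : Fin (suc t) → Fin r) → StrictlyIncreasing h → (∀ j → L (h j) ≡ a) →
    ∃ λ e → Avoids (M ∘ h ∘ punchIn e) π̂
  fibre-avoids {t = t} h h↑ L∘h≡a = e , M-avoids ∘ contains-π
    where
    e = proj₁ (extreme-insertable p-extreme t)
    hₑ↑ : StrictlyIncreasing (h ∘ punchIn e)
    hₑ↑ i j = h↑ _ _ ∘ punchIn-mono-< e
    contains-π : Contains (M ∘ h ∘ punchIn e) π̂ → Contains M π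
    contains-π (ρ , γ , occ@(_ , γ↑ , hit)) =
      replace-point {M = M} π π̂ x π≈π̂ (isOccurrence-∘ {M = M} {π = π̂} hₑ↑ occ)
        (proj₁ (L-anchors (h e)))
        (insertableAt-∘ h↑ (proj₂ (extreme-insertable p-extreme t) (ρ ∘ punchIn (π̂ ⟨$⟩ʳ x))))
        (subst (λ a → InsertableAt x a (γ ∘ punchIn x)) (trans (L∘h≡a _) (sym (L∘h≡a e)))
          (proj₂ (L-anchors _) γ γ↑ (hit x)))

  fibre-size : ∀ {r̂} → (∀ i → 2 * suc n ≤ ∣ M i ∣) → (∀ r′ → Admissible c π̂ r′ → r′ ≤ r̂) →
    ∀ {a} t (h : Fin t → Fin r) → StrictlyIncreasing h → (∀ j → L (h j) ≡ a) → t ≤ suc r̂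
  fibre-size rows maximal zero    h h↑ L∘h≡a = z≤n
  fibre-size rows maximal (suc t) h h↑ L∘h≡a with fibre-avoids h h↑ L∘h≡a
  ... | e , avoids = s≤s (maximal t (M ∘ h ∘ punchIn e , rows ∘ h ∘ punchIn e , avoids))

rows-bound : ∀ {r̂} (π π̂ : Permutation′ (suc n)) (x : Fin (suc n)) →
  Extreme x → Extreme (π ⟨$⟩ʳ x) → remove x π ≈ remove x π̂ →
  Admissible c π r → (∀ r′ → Admissible c π̂ r′ → r′ ≤ r̂) → r ≤ c * suc r̂
rows-bound {c = c} {r = r} {r̂ = r̂} π π̂ x x-extreme p-extreme π≈π̂ (M , rows , M-avoids) maximal = begin
  r                                      ≡⟨ sym (∑-fibres L) ⟩
  ∑[ a < c ] count (λ i → L i ≟ a)       ≤⟨ ∑-≤ _ fibre-bound ⟩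
  c * suc r̂                              ∎
  where
  open ℕ.≤-Reasoning
  anchorₗ : ∀ i → ∃ (Anchors x (M i))
  anchorₗ i = anchor x-extreme (M i) (∣p∣>0⇒nonempty (M i) (ℕ.≤-trans (s≤s z≤n) (rows i)))
  L : Fin r → Fin c
  L = proj₁ ∘ anchorₗ
  fibre-bound : ∀ a → count (λ i → L i ≟ a) ≤ suc r̂
  fibre-bound a with enumerate (λ i → L i ≟ a)
  ... | h , h↑ , L∘h≡a =
    fibre-size {π = π} {π̂ = π̂} {x = x} π≈π̂ p-extreme M-avoids (proj₂ ∘ anchorₗ) rows maximal _ h h↑ L∘h≡a

single-row-avoids : (M : Matrix 1 c) (π : Permutation′ (suc (suc n))) → Avoids M π
single-row-avoids M π (ρ , _ , ρ↑ , _) with ρ zero | ρ (suc zero) | ρ↑ zero (suc zero) (s≤s z≤n)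
... | zero | zero | ()

nonempty-contains-1×1 : (M : Matrix r c) (π : Permutation′ 1) {i : Fin r} → Nonempty (M i) → Contains M π
nonempty-contains-1×1 M π {i} (b , b∈Mi) =
  (λ _ → i) , (λ _ → b) , (λ { zero zero () }) , (λ { zero zero () }) , λ { zero → b∈Mi }

f-positive : ∀ {r̂} {π π̂ : Permutation′ (suc n)} → 2 * suc n ≤ c →
  Admissible c π (suc r) → (∀ r′ → Admissible c π̂ r′ → r′ ≤ r̂) → 1 ≤ r̂
f-positive {n = zero} {π = π} _ (M , rows , M-avoids) _ =
  ⊥-elim (M-avoids (nonempty-contains-1×1 M π (∣p∣>0⇒nonempty (M zero) (ℕ.≤-trans (s≤s z≤n) (rows zero)))))
f-positive {n = suc n} {π̂ = π̂} c≥ _ maximal =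
  maximal 1 ((λ _ → ⊤) , (λ _ → subst (_ ≤_) (sym (∣⊤∣≡n _)) c≥) , single-row-avoids (λ _ → ⊤) π̂)

f-ratio-bound : (π π̂ : Permutation′ (suc n)) (x : Fin (suc n)) →
  Extreme x → Extreme (π ⟨$⟩ʳ x) → remove x π ≈ remove x π̂ →
  ∀ c → 2 * suc n ≤ c → ∀ r r̂ → IsF c π r → IsF c π̂ r̂ → r ≤ 2 * c * r̂
f-ratio-bound π π̂ x x-extreme p-extreme π≈π̂ c c≥ zero    r̂ _ _ = z≤n
f-ratio-bound π π̂ x x-extreme p-extreme π≈π̂ c c≥ (suc r) r̂ (admissible , _) (_ , maximal) =
  begin
  suc r        ≤⟨ rows-bound π π̂ x x-extreme p-extreme π≈π̂ admissible maximal ⟩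
  c * suc r̂    ≤⟨ ℕ.*-monoʳ-≤ c (ℕ.+-monoˡ-≤ r̂ (f-positive {π = π} {π̂ = π̂} c≥ admissible maximal)) ⟩
  c * (r̂ + r̂)  ≡⟨ double c r̂ ⟩
  2 * c * r̂    ∎
  where
  open ℕ.≤-Reasoning
  double : ∀ c r̂ → c * (r̂ + r̂) ≡ 2 * c * r̂
  double = solve-∀

mainTheorem7 : ∀ (n : ℕ) (π : Permutation′ (suc n)) →
      (((π ⟨$⟩ʳ zero ≡ zero) ⊎ (π ⟨$⟩ʳ zero ≡ fromℕ n)) →
        ∀ (π̂ : Permutation′ (suc n)) → dleft π ≈ dleft π̂ →
        ∃ λ (C : ℕ) → ∀ (c : ℕ) → 2 * suc n ≤ c →
          ∀ (r r̂ : ℕ) → IsF c π r → IsF c π̂ r̂ → r ≤ C * c * r̂)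
    × (((π ⟨$⟩ʳ fromℕ n ≡ zero) ⊎ (π ⟨$⟩ʳ fromℕ n ≡ fromℕ n)) →
        ∀ (π̂ : Permutation′ (suc n)) → dright π ≈ dright π̂ →
        ∃ λ (C : ℕ) → ∀ (c : ℕ) → 2 * suc n ≤ c →
          ∀ (r r̂ : ℕ) → IsF c π r → IsF c π̂ r̂ → r ≤ C * c * r̂)
mainTheorem7 n π =
  (λ corner π̂ π≈π̂ → 2 , f-ratio-bound π π̂ zero (inj₁ refl) corner π≈π̂) ,
  (λ corner π̂ π≈π̂ → 2 , f-ratio-bound π π̂ (fromℕ n) (inj₂ refl) corner π≈π̂)
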